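{- For any graphs $G$ and $H$ with $\mathcal V(G)=\{v_1,\dots,v_k\}$, $$\alpha^*(G|H)\ge \frac{|\mathcal V(G)|}{\alpha(G^c\boxtimes H)},$$ and equality holds if $G$ is vertex-transitive (i.e. then $W=G^c$ attains the supremum defining $\alpha^*(G|H)$). Moreover, for any graph $G$ on vertices $v_1,\dots,v_k$, $\alpha(G^c\boxtimes H)=\max\sum_{i=1}^k|\mathcal T_i|$, where the maximum is over all collections $\mathcal T_1,\dots,\mathcal T_k\in\mathcal I(H)$ such that $\mathcal T_i$ and $\mathcal T_j$ are disconnected in $H$ whenever $i\ne j$ and there is no edge between $v_i$ and $v_j$ in $G$.
   Context: All graphs are finite, simple, undirected. $\alpha$ is the independence number, $\boxtimes$ the strong product, $G^c$ the complement. $\alpha^*(G|H)=\sup_W \frac{\alpha(G\boxtimes W)}{\alpha(H\boxtimes W)}$ over all graphs $W$. $\mathcal I(H)$ is the set of independent sets of $H$ (including $\emptyset$); $\mathcal S,\mathcal T\in\mathcal I(H)$ are disconnected in $H$ if $\mathcal S\cap\mathcal T=\emptyset$ and $\mathcal S\cup\mathcal T\in\mathcal I(H)$. A graph is vertex-transitive if its automorphism group acts transitively on its vertices. -}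

module Defs where

open import Data.Bool using (Bool; true; false; not; _∧_; _∨_; if_then_else_)
open import Data.Nat using (ℕ; zero; suc; _+_; _*_; _≤_; _<_; _⊔_)
open import Data.Fin using (Fin; _≟_; remQuot)
open import Data.Fin.Properties using (all?)
open import Data.Fin.Subset using (Subset; _∈_; _∉_; _∩_; _∪_; Empty; ∣_∣; inside; outside)
open import Data.Fin.Subset.Properties using (_∈?_)
open import Data.List using (List; []; _∷_; map; _++_; foldr; allFin)
open import Data.Nat.ListAction using (sum)
open import Data.Vec using (_∷_; [])
open import Data.Product using (Σ; _×_; _,_; proj₁; proj₂; ∃)
open import Relation.Nullary using (¬_; Dec; yes; no)
open import Relation.Nullary.Decidable using (⌊_⌋; _→-dec_; ¬?)
open import Relation.Binary.PropositionalEquality using (_≡_; _≢_)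
open import Data.Bool.Properties using () renaming (_≟_ to _≟ᵇ_)

record Graph : Set where
  constructor mkGraph
  field
    n   : ℕ
    adj : Fin n → Fin n → Bool
open Graph public

IsSimple : Graph → Set
IsSimple G = (∀ x y → adj G x y ≡ adj G y x) × (∀ x → adj G x x ≡ false)

_==_ : ∀ {m} → Fin m → Fin m → Bool
x == y = ⌊ x ≟ y ⌋

_ᶜ : Graph → Graph
G ᶜ = mkGraph (n G) (λ x y → not (x == y) ∧ not (adj G x y))

-- Strong product G ⊠ H on Fin (n G * n H) ≅ Fin (n G) × Fin (n H) (via remQuot):
-- distinct (u,v),(u',v') adjacent iff (u = u' or u ~ u') and (v = v' or v ~ v').
_⊠_ : Graph → Graph → Graph
G ⊠ H = mkGraph (n G * n H) λ x y →
  let u  = proj₁ (remQuot {n G} (n H) x) ; v  = proj₂ (remQuot {n G} (n H) x)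
      u' = proj₁ (remQuot {n G} (n H) y) ; v' = proj₂ (remQuot {n G} (n H) y)
  in not (x == y) ∧ ((u == u') ∨ adj G u u') ∧ ((v == v') ∨ adj H v v')

Independent : (G : Graph) → Subset (n G) → Set
Independent G S = ∀ x y → x ∈ S → y ∈ S → x ≢ y → adj G x y ≡ false

independent? : (G : Graph) (S : Subset (n G)) → Dec (Independent G S)
independent? G S = all? λ x → all? λ y →
  (x ∈? S) →-dec ((y ∈? S) →-dec (¬? (x ≟ y) →-dec (adj G x y ≟ᵇ false)))

allSubsets : (m : ℕ) → List (Subset m)
allSubsets zero = [] ∷ []
allSubsets (suc m) = map (outside ∷_) (allSubsets m) ++ map (inside ∷_) (allSubsets m)

α : Graph → ℕ
α G = foldr _⊔_ 0
  (map (λ S → if ⌊ independent? G S ⌋ then ∣ S ∣ else 0) (allSubsets (n G)))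

-- Ratio comparison via cross-multiplication (denominators positive):
-- a / b ≤ c / d
_/_≤_/_ : ℕ → ℕ → ℕ → ℕ → Set
a / b ≤ c / d = a * d ≤ c * b

-- Statements about α*(G|H) = sup_W α(G⊠W)/α(H⊠W), W ranging over
-- nonempty simple graphs (for empty W the ratio is 0/0).
-- α*(G|H) ≥ a/b : every nonnegative rational c/d < a/b is exceeded by some ratio.
αstar≥ : Graph → Graph → ℕ → ℕ → Set
αstar≥ G H a b = ∀ c d → 0 < d → c * b < a * d →
  Σ Graph λ W → IsSimple W × 0 < n W × (c * α (H ⊠ W) < α (G ⊠ W) * d)

αstar≤ : Graph → Graph → ℕ → ℕ → Set
αstar≤ G H a b = ∀ W → IsSimple W → 0 < n W → α (G ⊠ W) / α (H ⊠ W) ≤ a / b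

record Automorphism (G : Graph) : Set where
  field
    to      : Fin (n G) → Fin (n G)
    from    : Fin (n G) → Fin (n G)
    to-from : ∀ x → to (from x) ≡ x
    from-to : ∀ x → from (to x) ≡ x
    adj-pres : ∀ x y → adj G (to x) (to y) ≡ adj G x y
open Automorphism public

VertexTransitive : Graph → Set
VertexTransitive G = ∀ u v → Σ (Automorphism G) λ σ → to σ u ≡ v

Disconnected : (H : Graph) → Subset (n H) → Subset (n H) → Set
Disconnected H S T = Empty (S ∩ T) × Independent H (S ∪ T)

Admissible : (G H : Graph) → (Fin (n G) → Subset (n H)) → Set
Admissible G H T = (∀ i → Independent H (T i)) ×
  (∀ i j → i ≢ j → adj G i j ≡ false → Disconnected H (T i) (T j))

collectionSize : (G H : Graph) → (Fin (n G) → Subset (n H)) → ℕ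
collectionSize G H T = sum (map (λ i → ∣ T i ∣) (allFin (n G)))

IsMaxCollection : Graph → Graph → ℕ → Set
IsMaxCollection G H m =
  (Σ (Fin (n G) → Subset (n H)) λ T → Admissible G H T × collectionSize G H T ≡ m) ×
  (∀ T → Admissible G H T → collectionSize G H T ≤ m)

{-# OPTIONS --safe #-}
-- Lower bound: the diagonal {(v, v)} is independent in G ⊠ Gᶜ, so W = Gᶜ already gives the
-- ratio α(G ⊠ Gᶜ) / α(H ⊠ Gᶜ) ≥ |V(G)| / α(Gᶜ ⊠ H).
--
-- Upper bound for vertex-transitive G: fix maximum independent sets {(g a, w a)} of G ⊠ W and
-- {(g′ b, h b)} of Gᶜ ⊠ H. For an automorphism φ of G, the pairs (a, b) with φ (g a) = g′ b
-- give an independent set {(h b, w a)} of H ⊠ W. Every pair (a, b) is matched by as many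
-- automorphisms as the stabilizer of a vertex has elements, and there are at most |V(G)| times
-- that many automorphisms, so double counting gives α(G ⊠ W) α(Gᶜ ⊠ H) ≤ |V(G)| α(H ⊠ W).
--
-- Collections: a set S of vertices of Gᶜ ⊠ H is the family of its slices T i = {h | (i, h) ∈ S},
-- and S is independent exactly when this family is admissible.
module Submission where

open import Defs
open import Data.Bool using (Bool; true; false; not; _∧_; _∨_; if_then_else_)
open import Data.Bool.Properties using (∧-zeroʳ) renaming (_≟_ to _≟ᵇ_)
open import Data.Empty using (⊥-elim)
open import Data.Fin using (Fin; zero; suc; _≟_; fromℕ<; combine; remQuot; inject≤; finToFun; funToFin)
open import Data.Fin.Properties
  using (all?; any?; nonZeroIndex; suc-injective; combine-surjective; injective⇒≤; inject≤-injective; combine-injective;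
         combine-remQuot; remQuot-combine; finToFun-funToFin; funToFin-finToFin)
open import Data.Fin.Subset using (Subset; _∈_; ∣_∣; inside; outside; _∩_; _∪_; Empty; ⊥)
open import Data.Fin.Subset.Properties using (∉⊥; ∣⊥∣≡0; x∈p∩q⁺; x∈p∩q⁻; x∈p∪q⁺; x∈p∪q⁻)
open import Data.List using (List; map; allFin)
import Data.List as List
import Data.List.Membership.Propositional as ListMembership
open import Data.List.Membership.Propositional.Properties using (∈-map⁺; ∈-map⁻; ∈-++⁺ˡ; ∈-++⁺ʳ; foldr-selective)
open import Data.List.Properties using (foldr-forcesᵇ; map-cong; map-tabulate)
import Data.List.Relation.Unary.All as All
import Data.List.Relation.Unary.Any as Any
open import Data.Nat using (ℕ; zero; suc; _+_; _*_; _^_; _≤_; _<_; NonZero)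
open import Data.Nat.ListAction using (sum)
open import Data.Nat.Properties
  using (module ≤-Reasoning; ≤-refl; ≤-trans; ≤-antisym; ≤-<-trans; <-≤-trans; m⊔n≤o⇒m≤o; m⊔n≤o⇒n≤o; ⊔-sel;
         *-monoˡ-≤; *-monoʳ-≤; *-cancelʳ-≤; *-assoc; *-comm)
open import Data.Product using (Σ; ∃; _×_; _,_; proj₁; proj₂; uncurry)
open import Data.Product.Properties using (,-injective)
open import Data.Sum using (_⊎_; inj₁; inj₂)
open import Data.Vec using (_∷_; []; here; there; tabulate; lookup; splitAt; _++_)
open import Data.Vec.Properties
  using (lookup∘tabulate; tabulate∘lookup; tabulate-cong; lookup-++ˡ; lookup-++ʳ; []=⇒lookup; lookup⇒[]=)
open import Function using (_∘_; id)
open import Function.Definitions using (Injective)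
open import Relation.Nullary using (¬_; Dec; yes; no)
open import Relation.Nullary.Decidable using (⌊_⌋; _×-dec_; _→-dec_)
open import Relation.Binary.PropositionalEquality

private variable
  m k : ℕ

select : {P : Fin m → Set} → (∀ x → Dec (P x)) → Subset m
select P? = tabulate (λ x → ⌊ P? x ⌋)

module _ {P : Fin m → Set} (P? : ∀ x → Dec (P x)) {x : Fin m} where

  ∈-select⁺ : P x → x ∈ select P?
  ∈-select⁺ p = lookup⇒[]= x _ (trans (lookup∘tabulate _ x) (help (P? x) p))
    where
    help : (d : Dec (P x)) → P x → ⌊ d ⌋ ≡ true
    help (yes _) _ = refl
    help (no ¬p) p = ⊥-elim (¬p p)

  ∈-select⁻ : x ∈ select P? → P x
  ∈-select⁻ x∈ = help (P? x) (trans (sym (lookup∘tabulate _ x)) ([]=⇒lookup x∈))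
    where
    help : (d : Dec (P x)) → ⌊ d ⌋ ≡ true → P x
    help (yes p) _ = p

member : (S : Subset m) → Fin ∣ S ∣ → Fin m
member (outside ∷ S) i       = suc (member S i)
member (inside ∷ S)  zero    = zero
member (inside ∷ S)  (suc i) = suc (member S i)

member-∈ : (S : Subset m) (i : Fin ∣ S ∣) → member S i ∈ S
member-∈ (outside ∷ S) i       = there (member-∈ S i)
member-∈ (inside ∷ S)  zero    = here
member-∈ (inside ∷ S)  (suc i) = there (member-∈ S i)

member-injective : (S : Subset m) → Injective _≡_ _≡_ (member S)
member-injective (outside ∷ S) {i}     {j}     eq = member-injective S (suc-injective eq)
member-injective (inside ∷ S)  {zero}  {zero}  eq = refl
member-injective (inside ∷ S)  {suc i} {suc j} eq = cong suc (member-injective S (suc-injective eq))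

rank : (S : Subset m) {x : Fin m} → x ∈ S → Fin ∣ S ∣
rank (inside ∷ S)  here      = zero
rank (outside ∷ S) (there p) = rank S p
rank (inside ∷ S)  (there p) = suc (rank S p)

member-rank : (S : Subset m) {x : Fin m} (p : x ∈ S) → member S (rank S p) ≡ x
member-rank (inside ∷ S)  here      = refl
member-rank (outside ∷ S) (there p) = cong suc (member-rank S p)
member-rank (inside ∷ S)  (there p) = cong suc (member-rank S p)

rank-injective : (S : Subset m) {x y : Fin m} (p : x ∈ S) (q : y ∈ S) → rank S p ≡ rank S q → x ≡ y
rank-injective S p q eq = trans (sym (member-rank S p)) (trans (cong (member S) eq) (member-rank S q))

injective⇒≤∣∣ : (S : Subset m) (f : Fin k → Fin m) → Injective _≡_ _≡_ f → (∀ i → f i ∈ S) → k ≤ ∣ S ∣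
injective⇒≤∣∣ S f f-inj f∈S = injective⇒≤ (λ eq → f-inj (rank-injective S (f∈S _) (f∈S _) eq))

remQuot-injective : ∀ {a} b → Injective _≡_ _≡_ (remQuot {a} b)
remQuot-injective {a} b {x} {y} eq =
  trans (sym (combine-remQuot {a} b x)) (trans (cong (uncurry combine) eq) (combine-remQuot {a} b y))

uncurry-combine-injective : ∀ {a b} → Injective _≡_ _≡_ (uncurry (combine {a} {b}))
uncurry-combine-injective {x = i , j} {k , l} eq = let i≡k , j≡l = combine-injective i j k l eq in cong₂ _,_ i≡k j≡l

×-injective⇒≤ : ∀ {a b c d} (f : Fin a × Fin b → Fin c × Fin d) → Injective _≡_ _≡_ f → a * b ≤ c * d
×-injective⇒≤ {b = b} f f-inj =
  injective⇒≤ {f = uncurry combine ∘ f ∘ remQuot b}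
    (remQuot-injective b ∘ f-inj ∘ uncurry-combine-injective)

-- Subsets of Fin (m * k) ≅ Fin m × Fin k are m-indexed families of subsets of Fin k.
slice : Subset (m * k) → Fin m → Subset k
slice S i = tabulate (λ h → lookup S (combine i h))

glue : (Fin m → Subset k) → Subset (m * k)
glue {m} {k} T = tabulate (λ x → let i , h = remQuot {m} k x in lookup (T i) h)

∈-slice⁺ : (S : Subset (m * k)) {i : Fin m} {h : Fin k} → combine i h ∈ S → h ∈ slice S i
∈-slice⁺ S {i} {h} p = lookup⇒[]= h _ (trans (lookup∘tabulate _ h) ([]=⇒lookup p))

∈-slice⁻ : (S : Subset (m * k)) {i : Fin m} {h : Fin k} → h ∈ slice S i → combine i h ∈ S
∈-slice⁻ S {i} {h} p = lookup⇒[]= (combine i h) S (trans (sym (lookup∘tabulate _ h)) ([]=⇒lookup p))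

slice-glue : (T : Fin m → Subset k) (i : Fin m) → slice (glue T) i ≡ T i
slice-glue {m} {k} T i = trans (tabulate-cong λ h → trans (lookup∘tabulate _ (combine i h))
                                 (cong (λ (j , h) → lookup (T j) h) (remQuot-combine {m} {k} i h)))
                              (tabulate∘lookup (T i))

∣∣-++ : ∀ {a b} (S : Subset a) (S′ : Subset b) → ∣ S ++ S′ ∣ ≡ ∣ S ∣ + ∣ S′ ∣
∣∣-++ []            S′ = refl
∣∣-++ (outside ∷ S) S′ = ∣∣-++ S S′
∣∣-++ (inside ∷ S)  S′ = cong suc (∣∣-++ S S′)

∣∣≡sum-slices : ∀ m (S : Subset (m * k)) → ∣ S ∣ ≡ sum (map (∣_∣ ∘ slice S) (allFin m))
∣∣≡sum-slices zero    [] = refl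
∣∣≡sum-slices {k} (suc m) S with splitAt k S
... | S₀ , S′ , refl = begin
  ∣ S₀ ++ S′ ∣                                                   ≡⟨ ∣∣-++ S₀ S′ ⟩
  ∣ S₀ ∣ + ∣ S′ ∣                                                ≡⟨ cong₂ _+_ first-slice (∣∣≡sum-slices m S′) ⟩
  sizes zero + sum (map (∣_∣ ∘ slice {m} S′) (allFin m))          ≡⟨ cong (λ xs → sizes zero + sum xs) later-slices ⟩
  sizes zero + sum (map (sizes ∘ suc) (allFin m))                ≡⟨ cong (λ xs → sizes zero + sum xs) map-allFin-suc ⟩
  sum (map sizes (allFin (suc m)))                               ∎
  where
  open ≡-Reasoning
  sizes : Fin (suc m) → ℕ
  sizes = ∣_∣ ∘ slice {suc m} (S₀ ++ S′)
  first-slice : ∣ S₀ ∣ ≡ sizes zero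
  first-slice = cong ∣_∣ (sym (trans (tabulate-cong (lookup-++ˡ S₀ S′)) (tabulate∘lookup S₀)))
  later-slices : map (∣_∣ ∘ slice {m} S′) (allFin m) ≡ map (sizes ∘ suc) (allFin m)
  later-slices = map-cong (λ i → cong ∣_∣ (sym (tabulate-cong (λ h → lookup-++ʳ S₀ S′ (combine i h))))) (allFin m)
  map-allFin-suc : map (sizes ∘ suc) (allFin m) ≡ map sizes (List.tabulate suc)
  map-allFin-suc = trans (map-tabulate id (sizes ∘ suc)) (sym (map-tabulate suc sizes))

double-count : ∀ {N F r} (M : Fin F → Subset m) → (∀ f → ∣ M f ∣ ≤ r)
  → (cover : Fin m → Fin N → Fin F) → (∀ x → Injective _≡_ _≡_ (cover x)) → (∀ x j → x ∈ M (cover x j))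
  → m * N ≤ F * r
double-count {m} {N} {F} {r} M bounded cover cover-injective covers = ×-injective⇒≤ encode encode-injective
  where
  position : ∀ {x} f → x ∈ M f → Fin r
  position f p = inject≤ (rank (M f) p) (bounded f)

  encode : Fin m × Fin N → Fin F × Fin r
  encode (x , j) = cover x j , position (cover x j) (covers x j)

  position-injective : ∀ {x y f g} (p : x ∈ M f) (q : y ∈ M g) → f ≡ g → position f p ≡ position g q → x ≡ y
  position-injective {f = f} p q refl eq = rank-injective (M f) p q (inject≤-injective _ _ _ _ eq)

  encode-injective : Injective _≡_ _≡_ encode
  encode-injective {x , j} {y , k} eq with ,-injective eq
  ... | same-cover , same-position with position-injective (covers x j) (covers y k) same-cover same-position
  ... | refl = cong (x ,_) (cover-injective x same-cover)

Apart : (G : Graph) → Fin (n G) → Fin (n G) → Set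
Apart G x y = x ≢ y × adj G x y ≡ false

module _ {m : ℕ} {x y : Fin m} where

  ==-refl : x ≡ y → (x == y) ≡ true
  ==-refl x≡y with x ≟ y
  ... | yes _  = refl
  ... | no x≢y = ⊥-elim (x≢y x≡y)

  ==-false : x ≢ y → (x == y) ≡ false
  ==-false x≢y with x ≟ y
  ... | yes x≡y = ⊥-elim (x≢y x≡y)
  ... | no _    = refl

  ==-sym : (x == y) ≡ (y == x)
  ==-sym with x ≟ y | y ≟ x
  ... | yes _   | yes _   = refl
  ... | no _    | no _    = refl
  ... | yes x≡y | no y≢x  = ⊥-elim (y≢x (sym x≡y))
  ... | no x≢y  | yes y≡x = ⊥-elim (x≢y (sym y≡x))

near : (G : Graph) → Fin (n G) → Fin (n G) → Bool
near G x y = (x == y) ∨ adj G x y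

module _ (G : Graph) {x y : Fin (n G)} where

  Apart⇒near≡false : Apart G x y → near G x y ≡ false
  Apart⇒near≡false (x≢y , x≁y) rewrite ==-false x≢y = x≁y

  near≡false⇒Apart : near G x y ≡ false → Apart G x y
  near≡false⇒Apart eq with x ≟ y | adj G x y
  ... | no x≢y | false = x≢y , refl

  ᶜ-Apart⁺ : x ≢ y → adj G x y ≡ true → Apart (G ᶜ) x y
  ᶜ-Apart⁺ x≢y x∼y rewrite ==-false x≢y | x∼y = x≢y , refl

  ᶜ-Apart⁻ : Apart (G ᶜ) x y → adj G x y ≡ true
  ᶜ-Apart⁻ (x≢y , x≁ᶜy) rewrite ==-false x≢y with adj G x y
  ... | true = refl

  ≁⇒¬ᶜ-Apart : adj G x y ≡ false → ¬ Apart (G ᶜ) x y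
  ≁⇒¬ᶜ-Apart x≁y apart with trans (sym (ᶜ-Apart⁻ apart)) x≁y
  ... | ()

ᶜ-simple : (G : Graph) → IsSimple G → IsSimple (G ᶜ)
ᶜ-simple G (symmetric , irreflexive) =
  (λ x y → cong₂ (λ e a → not e ∧ not a) ==-sym (symmetric x y)) ,
  (λ x → cong (λ e → not e ∧ not (adj G x x)) (==-refl refl))

module _ (A B : Graph) {u u′ : Fin (n A)} {v v′ : Fin (n B)} where

  private
    adj-⊠-combine : adj (A ⊠ B) (combine u v) (combine u′ v′)
                  ≡ not (combine u v == combine u′ v′) ∧ near A u u′ ∧ near B v v′
    adj-⊠-combine = cong₂ (λ (i , j) (i′ , j′) → not (combine u v == combine u′ v′) ∧ near A i i′ ∧ near B j j′)
                          (remQuot-combine {n A} {n B} u v) (remQuot-combine {n A} {n B} u′ v′)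

  ⊠-Apart⁺ : Apart A u u′ ⊎ Apart B v v′ → Apart (A ⊠ B) (combine u v) (combine u′ v′)
  ⊠-Apart⁺ apart =
    distinct apart , trans adj-⊠-combine (trans (cong (not (combine u v == combine u′ v′) ∧_) (nears apart)) (∧-zeroʳ _))
    where
    distinct : Apart A u u′ ⊎ Apart B v v′ → combine u v ≢ combine u′ v′
    distinct (inj₁ (u≢u′ , _)) eq = u≢u′ (proj₁ (combine-injective u v u′ v′ eq))
    distinct (inj₂ (v≢v′ , _)) eq = v≢v′ (proj₂ (combine-injective u v u′ v′ eq))
    nears : Apart A u u′ ⊎ Apart B v v′ → near A u u′ ∧ near B v v′ ≡ false
    nears (inj₁ apartA) rewrite Apart⇒near≡false A apartA = refl
    nears (inj₂ apartB) rewrite Apart⇒near≡false B apartB = ∧-zeroʳ _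

  ⊠-Apart⁻ : Apart (A ⊠ B) (combine u v) (combine u′ v′) → Apart A u u′ ⊎ Apart B v v′
  ⊠-Apart⁻ (distinct , nonadjacent) with trans (sym adj-⊠-combine) nonadjacent
  ... | eq rewrite ==-false distinct with near A u u′ in nearA
  ... | false = inj₁ (near≡false⇒Apart A nearA)
  ... | true  = inj₂ (near≡false⇒Apart B eq)

allSubsets-complete : ∀ m (S : Subset m) → S ListMembership.∈ allSubsets m
allSubsets-complete zero    []            = Any.here refl
allSubsets-complete (suc m) (outside ∷ S) = ∈-++⁺ˡ (∈-map⁺ (outside ∷_) (allSubsets-complete m S))
allSubsets-complete (suc m) (inside ∷ S)  =
  ∈-++⁺ʳ (map (outside ∷_) (allSubsets m)) (∈-map⁺ (inside ∷_) (allSubsets-complete m S))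

module _ (G : Graph) where

  private
    score : Subset (n G) → ℕ
    score S = if ⌊ independent? G S ⌋ then ∣ S ∣ else 0

    scores : List ℕ
    scores = map score (allSubsets (n G))

    ∅-independent : Independent G ⊥
    ∅-independent x y x∈∅ = ⊥-elim (∉⊥ x∈∅)

    scores≤α : All.All (_≤ α G) scores
    scores≤α = foldr-forcesᵇ (λ a b a⊔b≤ → m⊔n≤o⇒m≤o a b a⊔b≤ , m⊔n≤o⇒n≤o a b a⊔b≤) 0 scores ≤-refl

  α-maximal : ∀ {S} → Independent G S → ∣ S ∣ ≤ α G
  α-maximal {S} independent with independent? G S | All.lookup scores≤α (∈-map⁺ score (allSubsets-complete (n G) S))
  ... | yes _        | ∣S∣≤α = ∣S∣≤α
  ... | no dependent | _     = ⊥-elim (dependent independent)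

  α-attained : Σ (Subset (n G)) λ S → Independent G S × ∣ S ∣ ≡ α G
  α-attained with foldr-selective ⊔-sel 0 scores
  ... | inj₁ α≡0 = ⊥ , ∅-independent , trans (∣⊥∣≡0 (n G)) (sym α≡0)
  ... | inj₂ α∈scores with ∈-map⁻ score α∈scores
  ...   | S , _ , α≡score with independent? G S
  ...     | yes independent = S , independent , sym α≡score
  ...     | no _            = ⊥ , ∅-independent , trans (∣⊥∣≡0 (n G)) (sym α≡score)

record IndependentFamily (G : Graph) (k : ℕ) : Set where
  field
    vertex : Fin k → Fin (n G)
    apart  : ∀ {i j} → i ≢ j → Apart G (vertex i) (vertex j)

  vertex-injective : Injective _≡_ _≡_ vertex
  vertex-injective {i} {j} eq with i ≟ j
  ... | yes i≡j = i≡j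
  ... | no i≢j  = ⊥-elim (proj₁ (apart i≢j) eq)

module _ {G : Graph} where

  IndependentFamily⇒≤α : IndependentFamily G k → k ≤ α G
  IndependentFamily⇒≤α {k} P =
    ≤-trans (injective⇒≤∣∣ image vertex vertex-injective (λ i → ∈-select⁺ occurs? (i , refl)))
            (α-maximal G image-independent)
    where
    open IndependentFamily P
    occurs? : ∀ x → Dec (∃ λ i → vertex i ≡ x)
    occurs? x = any? (λ i → vertex i ≟ x)
    image = select occurs?
    image-independent : Independent G image
    image-independent x y x∈ y∈ x≢y with ∈-select⁻ occurs? x∈ | ∈-select⁻ occurs? y∈
    ... | i , refl | j , refl = proj₂ (apart (λ i≡j → x≢y (cong vertex i≡j)))

  maximumIndependentFamily : IndependentFamily G (α G)
  maximumIndependentFamily with α-attained G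
  ... | S , independent , ∣S∣≡α = subst (IndependentFamily G) ∣S∣≡α record
    { vertex = member S
    ; apart  = λ i≢j → let distinct = i≢j ∘ member-injective S
                        in distinct , independent _ _ (member-∈ S _) (member-∈ S _) distinct
    }

record IndependentPairs (A B : Graph) (k : ℕ) : Set where
  field
    left  : Fin k → Fin (n A)
    right : Fin k → Fin (n B)
    apart : ∀ {i j} → i ≢ j → Apart A (left i) (left j) ⊎ Apart B (right i) (right j)

  swap : IndependentPairs B A k
  swap = record { left = right ; right = left ; apart = Data.Sum.swap ∘ apart }

module _ {A B : Graph} where

  IndependentPairs⇒≤α : IndependentPairs A B k → k ≤ α (A ⊠ B)
  IndependentPairs⇒≤α P = IndependentFamily⇒≤α record
    { vertex = λ i → combine (left i) (right i)
    ; apart  = ⊠-Apart⁺ A B ∘ apart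
    }
    where open IndependentPairs P

  maximumIndependentPairs : IndependentPairs A B (α (A ⊠ B))
  maximumIndependentPairs = record
    { left  = proj₁ ∘ coordinates
    ; right = proj₂ ∘ coordinates
    ; apart = λ i≢j → ⊠-Apart⁻ A B (subst₂ (Apart (A ⊠ B)) (sym (combine-remQuot {n A} (n B) _))
                                                             (sym (combine-remQuot {n A} (n B) _)) (apart i≢j))
    }
    where
    open IndependentFamily (maximumIndependentFamily {A ⊠ B})
    coordinates = remQuot {n A} (n B) ∘ vertex

α-⊠-comm-≤ : (A B : Graph) → α (A ⊠ B) ≤ α (B ⊠ A)
α-⊠-comm-≤ A B = IndependentPairs⇒≤α (IndependentPairs.swap (maximumIndependentPairs {A} {B}))

diagonal : (G : Graph) → IndependentPairs G (G ᶜ) (n G)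
diagonal G = record { left = id ; right = id ; apart = apart }
  where
  apart : ∀ {i j} → i ≢ j → Apart G i j ⊎ Apart (G ᶜ) i j
  apart {i} {j} i≢j = by-adjacency (adj G i j) refl
    where
    by-adjacency : ∀ b → adj G i j ≡ b → Apart G i j ⊎ Apart (G ᶜ) i j
    by-adjacency false i≁j = inj₁ (i≢j , i≁j)
    by-adjacency true  i∼j = inj₂ (ᶜ-Apart⁺ G i≢j i∼j)

n≤α-⊠ᶜ : (G : Graph) → n G ≤ α (G ⊠ (G ᶜ))
n≤α-⊠ᶜ G = IndependentPairs⇒≤α (diagonal G)

module _ (G H : Graph) where

  private
    variable
      i j : Fin (n G)
      a b : Fin (n H)

    separated : ∀ {S} → Independent ((G ᶜ) ⊠ H) S → combine i a ∈ S → combine j b ∈ S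
              → combine i a ≢ combine j b → Apart (G ᶜ) i j ⊎ Apart H a b
    separated independent p q distinct = ⊠-Apart⁻ (G ᶜ) H (distinct , independent _ _ p q distinct)

  independent⇒admissible : IsSimple G → ∀ {S} → Independent ((G ᶜ) ⊠ H) S → Admissible G H (slice S)
  independent⇒admissible (symmetric , _) {S} independent = slice-independent , slices-disconnected
    where
    from-slices : a ∈ slice S i → b ∈ slice S j → combine i a ≢ combine j b → Apart (G ᶜ) i j ⊎ Apart H a b
    from-slices p q = separated independent (∈-slice⁻ {n G} S p) (∈-slice⁻ {n G} S q)

    apart-in-H : ¬ Apart (G ᶜ) i j → a ∈ slice S i → b ∈ slice S j → a ≢ b → adj H a b ≡ false
    apart-in-H ¬apart p q a≢b with from-slices p q (a≢b ∘ proj₂ ∘ combine-injective {n G} _ _ _ _)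
    ... | inj₁ apart         = ⊥-elim (¬apart apart)
    ... | inj₂ (_ , a≁b)     = a≁b

    slice-independent : ∀ i → Independent H (slice S i)
    slice-independent i a b p q = apart-in-H (λ apart → proj₁ apart refl) p q

    slices-disconnected : ∀ i j → i ≢ j → adj G i j ≡ false → Disconnected H (slice S i) (slice S j)
    slices-disconnected i j i≢j i≁j = disjoint , union-independent
      where
      disjoint : Empty (slice S i ∩ slice S j)
      disjoint (a , a∈∩) with x∈p∩q⁻ (slice S i) (slice S j) a∈∩
      ... | p , q with from-slices p q (i≢j ∘ proj₁ ∘ combine-injective {n G} _ _ _ _)
      ...   | inj₁ apart        = ≁⇒¬ᶜ-Apart G i≁j apart
      ...   | inj₂ (a≢a , _)    = a≢a refl
      union-independent : Independent H (slice S i ∪ slice S j)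
      union-independent a b p q with x∈p∪q⁻ (slice S i) _ p | x∈p∪q⁻ (slice S i) _ q
      ... | inj₁ p | inj₁ q = slice-independent i a b p q
      ... | inj₂ p | inj₂ q = slice-independent j a b p q
      ... | inj₁ p | inj₂ q = apart-in-H (≁⇒¬ᶜ-Apart G i≁j) p q
      ... | inj₂ p | inj₁ q = apart-in-H (≁⇒¬ᶜ-Apart G (trans (symmetric j i) i≁j)) p q

  admissible⇒independent : ∀ {T} → Admissible G H T → Independent ((G ᶜ) ⊠ H) (glue T)
  admissible⇒independent {T} (T-independent , T-disconnected) x y p q x≢y
    with combine-surjective {n G} {n H} x | combine-surjective {n G} {n H} y
  ... | _ , _ , refl | _ , _ , refl = proj₂ (⊠-Apart⁺ (G ᶜ) H (apartness (∈-glue p) (∈-glue q) x≢y))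
    where
    ∈-glue : ∀ {i a} → combine i a ∈ glue T → a ∈ T i
    ∈-glue {i} p = subst (_ ∈_) (slice-glue T i) (∈-slice⁺ {n G} (glue T) p)

    apartness : ∀ {i j a b} → a ∈ T i → b ∈ T j → combine i a ≢ combine j b → Apart (G ᶜ) i j ⊎ Apart H a b
    apartness {i} {j} {a} {b} p q distinct = by-equality (i ≟ j)
      where
      by-equality : Dec (i ≡ j) → Apart (G ᶜ) i j ⊎ Apart H a b
      by-equality (yes refl) = inj₂ (a≢b , T-independent i a b p q a≢b)
        where a≢b = λ a≡b → distinct (cong (combine i) a≡b)
      by-equality (no i≢j) = by-adjacency (adj G i j) refl
        where
        by-adjacency : ∀ c → adj G i j ≡ c → Apart (G ᶜ) i j ⊎ Apart H a b
        by-adjacency true  i∼j = inj₁ (ᶜ-Apart⁺ G i≢j i∼j)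
        by-adjacency false i≁j with T-disconnected i j i≢j i≁j
        ... | disjoint , union-independent =
          inj₂ (a≢b , union-independent a b (x∈p∪q⁺ (inj₁ p)) (x∈p∪q⁺ (inj₂ q)) a≢b)
          where
          a≢b : a ≢ b
          a≢b refl = disjoint (a , x∈p∩q⁺ (p , q))

  α-⊠ᶜ-isMaxCollection : IsSimple G → IsMaxCollection G H (α ((G ᶜ) ⊠ H))
  α-⊠ᶜ-isMaxCollection simple with α-attained ((G ᶜ) ⊠ H)
  ... | S , S-independent , ∣S∣≡α =
    (slice S , independent⇒admissible simple S-independent , trans (sym (∣∣≡sum-slices (n G) S)) ∣S∣≡α) ,
    λ T admissible → begin
      collectionSize G H T
        ≡⟨ cong sum (map-cong (cong ∣_∣ ∘ sym ∘ slice-glue T) (allFin (n G))) ⟩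
      sum (map (∣_∣ ∘ slice (glue T)) (allFin (n G)))
        ≡⟨ sym (∣∣≡sum-slices (n G) (glue T)) ⟩
      ∣ glue T ∣
        ≤⟨ α-maximal ((G ᶜ) ⊠ H) (admissible⇒independent admissible) ⟩
      α ((G ᶜ) ⊠ H) ∎
    where open ≤-Reasoning

-- On a finite vertex set these are exactly the automorphisms.
IsEmbedding : (G : Graph) → (Fin (n G) → Fin (n G)) → Set
IsEmbedding G φ = (∀ x y → φ x ≡ φ y → x ≡ y) × (∀ x y → adj G (φ x) (φ y) ≡ adj G x y)

module _ {G : Graph} where

  isEmbedding? : ∀ φ → Dec (IsEmbedding G φ)
  isEmbedding? φ = (all? λ x → all? λ y → (φ x ≟ φ y) →-dec (x ≟ y))
             ×-dec (all? λ x → all? λ y → adj G (φ x) (φ y) ≟ᵇ adj G x y)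

  IsEmbedding-resp-≗ : ∀ {φ ψ} → (∀ x → φ x ≡ ψ x) → IsEmbedding G φ → IsEmbedding G ψ
  IsEmbedding-resp-≗ φ≗ψ (injective , preserves) =
    (λ x y eq → injective x y (trans (φ≗ψ x) (trans eq (sym (φ≗ψ y))))) ,
    (λ x y → trans (sym (cong₂ (adj G) (φ≗ψ x) (φ≗ψ y))) (preserves x y))

  IsEmbedding-∘ : ∀ {φ ψ} → IsEmbedding G φ → IsEmbedding G ψ → IsEmbedding G (φ ∘ ψ)
  IsEmbedding-∘ (φ-injective , φ-preserves) (ψ-injective , ψ-preserves) =
    (λ x y eq → ψ-injective x y (φ-injective _ _ eq)) ,
    (λ x y → trans (φ-preserves _ _) (ψ-preserves x y))

  id-isEmbedding : IsEmbedding G id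
  id-isEmbedding = (λ x y eq → eq) , (λ x y → refl)

  to-isEmbedding : (σ : Automorphism G) → IsEmbedding G (to σ)
  to-isEmbedding σ = (λ x y eq → trans (sym (from-to σ x)) (trans (cong (from σ) eq) (from-to σ y))) , adj-pres σ

  from-isEmbedding : (σ : Automorphism G) → IsEmbedding G (from σ)
  from-isEmbedding σ =
    (λ x y eq → trans (sym (to-from σ x)) (trans (cong (to σ) eq) (to-from σ y))) ,
    (λ x y → trans (sym (adj-pres σ (from σ x) (from σ y))) (cong₂ (adj G) (to-from σ x) (to-from σ y)))

  IsEmbedding⇒Apart : ∀ {φ x y} → IsEmbedding G φ → Apart G x y → Apart G (φ x) (φ y)
  IsEmbedding⇒Apart (injective , preserves) (x≢y , x≁y) = x≢y ∘ injective _ _ , trans (preserves _ _) x≁y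

record Stabilizer (G : Graph) (v : Fin (n G)) : Set where
  field
    size              : ℕ
    element           : Fin size → Fin (n G) → Fin (n G)
    element-embedding : ∀ k → IsEmbedding G (element k)
    element-fixes     : ∀ k → element k v ≡ v
    index             : ∀ φ → IsEmbedding G φ → φ v ≡ v → Fin size
    element-index     : ∀ φ e f x → element (index φ e f) x ≡ φ x
    element-injective : ∀ {k k′} → (∀ x → element k x ≡ element k′ x) → k ≡ k′

  size-nonZero : NonZero size
  size-nonZero = nonZeroIndex (index id id-isEmbedding refl)

funToFin-cong : ∀ {a b} {φ ψ : Fin a → Fin b} → (∀ x → φ x ≡ ψ x) → funToFin φ ≡ funToFin ψ
funToFin-cong {zero}  φ≗ψ = refl
funToFin-cong {suc a} φ≗ψ = cong₂ combine (φ≗ψ zero) (funToFin-cong (φ≗ψ ∘ suc))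

finToFun-injective : ∀ {a b} {i j : Fin (b ^ a)} → (∀ x → finToFun {b} {a} i x ≡ finToFun j x) → i ≡ j
finToFun-injective {a} {b} {i} {j} eq =
  trans (sym (funToFin-finToFin {a} {b} i)) (trans (funToFin-cong eq) (funToFin-finToFin {a} {b} j))

stabilizer : (G : Graph) (v : Fin (n G)) → Stabilizer G v
stabilizer G v = record
  { size              = ∣ codes ∣
  ; element           = decode ∘ member codes
  ; element-embedding = λ k → proj₁ (∈-select⁻ fixing? (member-∈ codes k))
  ; element-fixes     = λ k → proj₂ (∈-select⁻ fixing? (member-∈ codes k))
  ; index             = λ φ e f → rank codes (code∈codes φ e f)
  ; element-index     = λ φ e f x → trans (cong (λ c → decode c x) (member-rank codes (code∈codes φ e f)))
                                          (finToFun-funToFin φ x)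
  ; element-injective = member-injective codes ∘ finToFun-injective {n G} {n G}
  }
  where
  decode : Fin (n G ^ n G) → Fin (n G) → Fin (n G)
  decode = finToFun

  Fixing : Fin (n G ^ n G) → Set
  Fixing c = IsEmbedding G (decode c) × decode c v ≡ v

  fixing? : ∀ c → Dec (Fixing c)
  fixing? c = isEmbedding? (decode c) ×-dec (decode c v ≟ v)

  codes : Subset (n G ^ n G)
  codes = select fixing?

  code∈codes : ∀ φ → IsEmbedding G φ → φ v ≡ v → funToFin φ ∈ codes
  code∈codes φ e f =
    ∈-select⁺ fixing? (IsEmbedding-resp-≗ (sym ∘ finToFun-funToFin φ) e , trans (finToFun-funToFin φ v) f)

module Matching {G H W : Graph} {s t : ℕ} (P : IndependentPairs G W s) (Q : IndependentPairs (G ᶜ) H t) where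
  open IndependentPairs P renaming (left to g; right to w; apart to P-apart)
  open IndependentPairs Q renaming (left to g′; right to h; apart to Q-apart)

  matching : (Fin (n G) → Fin (n G)) → Subset (s * t)
  matching φ = select (λ c → let a , b = remQuot {s} t c in φ (g a) ≟ g′ b)

  ∈-matching⁺ : ∀ {φ c} → let a , b = remQuot {s} t c in φ (g a) ≡ g′ b → c ∈ matching φ
  ∈-matching⁺ {φ} = ∈-select⁺ (λ c → let a , b = remQuot {s} t c in φ (g a) ≟ g′ b)

  ∈-matching⁻ : ∀ {φ c} → c ∈ matching φ → let a , b = remQuot {s} t c in φ (g a) ≡ g′ b
  ∈-matching⁻ {φ} = ∈-select⁻ (λ c → let a , b = remQuot {s} t c in φ (g a) ≟ g′ b)

  matched-Apart : ∀ {φ a a′ b b′} → IsEmbedding G φ → φ (g a) ≡ g′ b → φ (g a′) ≡ g′ b′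
                → (a , b) ≢ (a′ , b′) → Apart H (h b) (h b′) ⊎ Apart W (w a) (w a′)
  matched-Apart {φ} {a} {a′} {b} {b′} embedding φga≡g′b φga′≡g′b′ distinct = by-equality (a ≟ a′)
    where
    apart-in-H : b ≢ b′ → ¬ Apart (G ᶜ) (g′ b) (g′ b′) → Apart H (h b) (h b′) ⊎ Apart W (w a) (w a′)
    apart-in-H b≢b′ ¬apart with Q-apart b≢b′
    ... | inj₁ apart  = ⊥-elim (¬apart apart)
    ... | inj₂ apart  = inj₁ apart

    by-equality : Dec (a ≡ a′) → Apart H (h b) (h b′) ⊎ Apart W (w a) (w a′)
    by-equality (yes refl) =
      apart-in-H (distinct ∘ cong (a ,_)) λ (g′b≢g′b′ , _) → g′b≢g′b′ (trans (sym φga≡g′b) φga′≡g′b′)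
    -- φ carries apartness of g a, g a′ in G to g′ b, g′ b′, which rules out apartness in Gᶜ.
    by-equality (no a≢a′) with P-apart a≢a′
    ... | inj₂ apart = inj₂ apart
    ... | inj₁ apart with subst₂ (Apart G) φga≡g′b φga′≡g′b′ (IsEmbedding⇒Apart embedding apart)
    ...   | g′b≢g′b′ , g′b≁g′b′ = apart-in-H (λ { refl → g′b≢g′b′ refl }) (≁⇒¬ᶜ-Apart G g′b≁g′b′)

  ∣matching∣≤α : ∀ {φ} → IsEmbedding G φ → ∣ matching φ ∣ ≤ α (H ⊠ W)
  ∣matching∣≤α {φ} embedding = IndependentPairs⇒≤α {H} {W} record
    { left  = h ∘ proj₂ ∘ pair
    ; right = w ∘ proj₁ ∘ pair
    ; apart = λ i≢j → matched-Apart embedding (matches _) (matches _)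
                                      (i≢j ∘ member-injective (matching φ) ∘ remQuot-injective t)
    }
    where
    pair : Fin ∣ matching φ ∣ → Fin s × Fin t
    pair = remQuot t ∘ member (matching φ)
    matches : ∀ i → φ (g (proj₁ (pair i))) ≡ g′ (proj₂ (pair i))
    matches i = ∈-matching⁻ {φ} (member-∈ (matching φ) i)

module _ {G : Graph} (transitive : VertexTransitive G) (v₀ : Fin (n G)) where

  open Stabilizer (stabilizer G v₀)

  private
    τ : Fin (n G) → Automorphism G
    τ u = proj₁ (transitive v₀ u)

    τ-v₀ : ∀ u → to (τ u) v₀ ≡ u
    τ-v₀ u = proj₂ (transitive v₀ u)

  embeddingOf : Fin (n G * size) → Fin (n G) → Fin (n G)
  embeddingOf f = let u , k = remQuot size f in to (τ u) ∘ element k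

  embeddingOf-isEmbedding : ∀ f → IsEmbedding G (embeddingOf f)
  embeddingOf-isEmbedding f = let u , r = remQuot size f in IsEmbedding-∘ (to-isEmbedding (τ u)) (element-embedding r)

  private
    untranslate : (Fin (n G) → Fin (n G)) → Fin (n G) → Fin (n G)
    untranslate φ = from (τ (φ v₀)) ∘ φ

    untranslate-embedding : ∀ {φ} → IsEmbedding G φ → IsEmbedding G (untranslate φ)
    untranslate-embedding {φ} = IsEmbedding-∘ (from-isEmbedding (τ (φ v₀)))

    untranslate-fixes : ∀ φ → untranslate φ v₀ ≡ v₀
    untranslate-fixes φ = trans (cong (from (τ (φ v₀))) (sym (τ-v₀ (φ v₀)))) (from-to (τ (φ v₀)) v₀)

  -- φ = τ (φ v₀) ∘ (τ (φ v₀)⁻¹ ∘ φ), and the second factor fixes v₀.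
  encode : ∀ φ → IsEmbedding G φ → Fin (n G * size)
  encode φ e = combine (φ v₀) (index (untranslate φ) (untranslate-embedding e) (untranslate-fixes φ))

  embeddingOf-encode : ∀ φ e x → embeddingOf (encode φ e) x ≡ φ x
  embeddingOf-encode φ e x = begin
    embeddingOf (combine u r) x       ≡⟨ cong (λ (u , r) → to (τ u) (element r x)) (remQuot-combine u r) ⟩
    to (τ u) (element r x)          ≡⟨ cong (to (τ u)) (element-index _ (untranslate-embedding e) (untranslate-fixes φ) x) ⟩
    to (τ u) (from (τ u) (φ x))     ≡⟨ to-from (τ u) (φ x) ⟩
    φ x                             ∎
    where
    open ≡-Reasoning
    u = φ v₀
    r = index (untranslate φ) (untranslate-embedding e) (untranslate-fixes φ)

  encode-≗ : ∀ {φ ψ} e e′ → encode φ e ≡ encode ψ e′ → ∀ x → φ x ≡ ψ x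
  encode-≗ {φ} {ψ} e e′ eq x =
    trans (sym (embeddingOf-encode φ e x)) (trans (cong (λ f → embeddingOf f x) eq) (embeddingOf-encode ψ e′ x))

  independentPairs-product≤ : ∀ {H W s t} → IndependentPairs G W s → IndependentPairs (G ᶜ) H t → s * t ≤ n G * α (H ⊠ W)
  independentPairs-product≤ {H} {W} {s} {t} P Q = *-cancelʳ-≤ (s * t) (n G * α (H ⊠ W)) size {{size-nonZero}} counted
    where
    open Matching P Q
    open IndependentPairs P using () renaming (left to g)
    open IndependentPairs Q using () renaming (left to g′)

    through : Fin s → Fin t → Fin size → Fin (n G) → Fin (n G)
    through a b j = to (τ (g′ b)) ∘ element j ∘ from (τ (g a))

    through-embedding : ∀ a b j → IsEmbedding G (through a b j)
    through-embedding a b j =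
      IsEmbedding-∘ (to-isEmbedding (τ (g′ b))) (IsEmbedding-∘ (element-embedding j) (from-isEmbedding (τ (g a))))

    through-maps : ∀ a b j → through a b j (g a) ≡ g′ b
    through-maps a b j = begin
      to (τ (g′ b)) (element j (from (τ (g a)) (g a)))             ≡⟨ cong (λ x → to (τ (g′ b)) (element j (from (τ (g a)) x))) (τ-v₀ (g a)) ⟨
      to (τ (g′ b)) (element j (from (τ (g a)) (to (τ (g a)) v₀))) ≡⟨ cong (to (τ (g′ b)) ∘ element j) (from-to (τ (g a)) v₀) ⟩
      to (τ (g′ b)) (element j v₀)                                 ≡⟨ cong (to (τ (g′ b))) (element-fixes j) ⟩
      to (τ (g′ b)) v₀                                             ≡⟨ τ-v₀ (g′ b) ⟩
      g′ b                                                         ∎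
      where open ≡-Reasoning

    element-through : ∀ a b j y → element j y ≡ from (τ (g′ b)) (through a b j (to (τ (g a)) y))
    element-through a b j y =
      trans (cong (element j) (sym (from-to (τ (g a)) y))) (sym (from-to (τ (g′ b)) _))

    cover : Fin (s * t) → Fin size → Fin (n G * size)
    cover c j = let a , b = remQuot t c in encode (through a b j) (through-embedding a b j)

    covers : ∀ c j → c ∈ matching (embeddingOf (cover c j))
    covers c j = let a , b = remQuot t c in
      ∈-matching⁺ {embeddingOf (cover c j)} {c}
        (trans (embeddingOf-encode _ (through-embedding a b j) (g a)) (through-maps a b j))

    cover-injective : ∀ c → Injective _≡_ _≡_ (cover c)
    cover-injective c {j} {j′} eq = element-injective λ y →
      trans (element-through a b j y)
            (trans (cong (from (τ (g′ b))) (encode-≗ (through-embedding a b j) (through-embedding a b j′) eq _))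
                   (sym (element-through a b j′ y)))
      where
      a = proj₁ (remQuot {s} t c)
      b = proj₂ (remQuot {s} t c)

    counted : s * t * size ≤ n G * α (H ⊠ W) * size
    counted = begin
      s * t * size             ≤⟨ double-count (matching ∘ embeddingOf) (∣matching∣≤α ∘ embeddingOf-isEmbedding)
                                               cover cover-injective covers ⟩
      n G * size * α (H ⊠ W)   ≡⟨ *-assoc (n G) size _ ⟩
      n G * (size * α (H ⊠ W)) ≡⟨ cong (n G *_) (*-comm size _) ⟩
      n G * (α (H ⊠ W) * size) ≡⟨ *-assoc (n G) _ size ⟨
      n G * α (H ⊠ W) * size   ∎
      where open ≤-Reasoning

αstar≥-complement : (G H : Graph) → IsSimple G → 0 < n G → αstar≥ G H (n G) (α ((G ᶜ) ⊠ H))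
αstar≥-complement G H simple n>0 c d _ c*α<n*d = G ᶜ , ᶜ-simple G simple , n>0 ,
  ≤-<-trans (*-monoʳ-≤ c (α-⊠-comm-≤ H (G ᶜ))) (<-≤-trans c*α<n*d (*-monoˡ-≤ d (n≤α-⊠ᶜ G)))

αstar≤-transitive : (G H : Graph) → VertexTransitive G → 0 < n G → αstar≤ G H (n G) (α ((G ᶜ) ⊠ H))
αstar≤-transitive G H transitive n>0 W _ _ =
  independentPairs-product≤ transitive (fromℕ< n>0) (maximumIndependentPairs {G} {W}) (maximumIndependentPairs {G ᶜ} {H})

complement-attains-αstar : (G H : Graph) → IsSimple G → 0 < n G → αstar≤ G H (n G) (α ((G ᶜ) ⊠ H))
  → α (G ⊠ (G ᶜ)) * α ((G ᶜ) ⊠ H) ≡ n G * α (H ⊠ (G ᶜ))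
complement-attains-αstar G H simple n>0 upper = ≤-antisym (upper (G ᶜ) (ᶜ-simple G simple) n>0)
  (≤-trans (*-monoʳ-≤ (n G) (α-⊠-comm-≤ H (G ᶜ))) (*-monoˡ-≤ _ (n≤α-⊠ᶜ G)))

theorem5 : (G H : Graph) → IsSimple G → IsSimple H
    → (0 < n G → 0 < n H → αstar≥ G H (n G) (α ((G ᶜ) ⊠ H)))
    × (0 < n G → 0 < n H → VertexTransitive G
        → αstar≤ G H (n G) (α ((G ᶜ) ⊠ H))
          × (α (G ⊠ (G ᶜ)) * α ((G ᶜ) ⊠ H) ≡ n G * α (H ⊠ (G ᶜ))))
    × IsMaxCollection G H (α ((G ᶜ) ⊠ H))
theorem5 G H simple _ =
  (λ n>0 _ → αstar≥-complement G H simple n>0) ,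
  (λ n>0 _ transitive → let upper = αstar≤-transitive G H transitive n>0
                        in upper , complement-attains-αstar G H simple n>0 upper) ,
  α-⊠ᶜ-isMaxCollection G H simple
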